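{- Let $G$ be a finite graph of order $n$ and let $P_2$ be the path on two vertices. Then $\gamma_{1/2}(G \square P_2) \geq \gamma_{1/2}(G)$.
   Context: For a graph $G=(V,E)$ and a vertex $v$, $N[v]$ denotes the closed neighborhood of $v$, and for $S\subseteq V$, $N[S]=\bigcup_{u\in S}N[u]$. For $p\in[0,1]$, a set $S\subseteq V$ is a $p$-dominating set if $|N[S]|/|V|\geq p$; $\gamma_p(G)$ is the minimum cardinality of a $p$-dominating set of $G$. $G\square H$ denotes the Cartesian product of graphs $G$ and $H$. -}

module Defs where

open import Data.Nat using (ℕ; _*_; _≤_)
open import Data.Bool using (Bool; true; false; _∧_; _∨_; not)
open import Data.Fin using (Fin; zero; suc; _≟_; combine; remQuot)
open import Data.Fin.Subset using (Subset; ∣_∣; _∈_)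
open import Data.Vec using (tabulate; lookup)
open import Data.Product using (Σ; _×_; _,_; proj₁; proj₂; ∃)
open import Relation.Nullary.Decidable using (⌊_⌋)
open import Relation.Binary.PropositionalEquality using (_≡_; refl; sym)
open import Relation.Nullary using (yes; no)
open import Data.Empty using (⊥-elim)
import Data.Bool.Properties

record Graph (n : ℕ) : Set where
  field
    adj    : Fin n → Fin n → Bool
    adj-sym    : ∀ u v → adj u v ≡ adj v u
    adj-irrefl : ∀ v → adj v v ≡ false
open Graph public

anyFin : ∀ {n} → (Fin n → Bool) → Bool
anyFin {ℕ.zero}  f = false
anyFin {ℕ.suc n} f = f zero ∨ anyFin (λ i → f (suc i))

inClosedNbhd : ∀ {n} → Graph n → Fin n → Fin n → Bool
inClosedNbhd G v u = ⌊ u ≟ v ⌋ ∨ adj G v u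

N[_]_ : ∀ {n} → Graph n → Subset n → Subset n
N[ G ] S = tabulate (λ u → anyFin (λ v → lookup S v ∧ inClosedNbhd G v u))

-- S is a 1/2-dominating set:  |N[S]| / |V| ≥ 1/2, i.e. 2·|N[S]| ≥ |V| = n.
IsHalfDominating : ∀ {n} → Graph n → Subset n → Set
IsHalfDominating {n} G S = n ≤ 2 * ∣ N[ G ] S ∣

IsGammaHalf : ∀ {n} → Graph n → ℕ → Set
IsGammaHalf G k =
  (Σ (Subset _) λ S → IsHalfDominating G S × ∣ S ∣ ≡ k)
  × (∀ S → IsHalfDominating G S → k ≤ ∣ S ∣)

P₂ : Graph 2
P₂ = record { adj = a ; adj-sym = s ; adj-irrefl = i }
  where
  a : Fin 2 → Fin 2 → Bool
  a zero (suc zero) = true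
  a (suc zero) zero = true
  a _ _ = false
  s : ∀ u v → a u v ≡ a v u
  s zero zero = Relation.Binary.PropositionalEquality.refl
  s zero (suc zero) = Relation.Binary.PropositionalEquality.refl
  s (suc zero) zero = Relation.Binary.PropositionalEquality.refl
  s (suc zero) (suc zero) = Relation.Binary.PropositionalEquality.refl
  i : ∀ v → a v v ≡ false
  i zero = Relation.Binary.PropositionalEquality.refl
  i (suc zero) = Relation.Binary.PropositionalEquality.refl

□adj : ∀ {n m} → Graph n → Graph m → Fin n × Fin m → Fin n × Fin m → Bool
□adj G H (g , h) (g' , h') = (⌊ g ≟ g' ⌋ ∧ adj H h h') ∨ (⌊ h ≟ h' ⌋ ∧ adj G g g')

private
  ⌊≟⌋-sym : ∀ {k} (x y : Fin k) → ⌊ x ≟ y ⌋ ≡ ⌊ y ≟ x ⌋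
  ⌊≟⌋-sym x y with x ≟ y | y ≟ x
  ... | yes _ | yes _ = refl
  ... | no _  | no _  = refl
  ... | yes p | no q  = ⊥-elim (q (sym p))
  ... | no q  | yes p = ⊥-elim (q (sym p))

  ⌊≟⌋-refl : ∀ {k} (x : Fin k) → ⌊ x ≟ x ⌋ ≡ true
  ⌊≟⌋-refl x with x ≟ x
  ... | yes _ = refl
  ... | no q  = ⊥-elim (q refl)

□adj-sym : ∀ {n m} (G : Graph n) (H : Graph m) x y → □adj G H x y ≡ □adj G H y x
□adj-sym G H (g , h) (g' , h')
  rewrite ⌊≟⌋-sym g g' | ⌊≟⌋-sym h h' | Graph.adj-sym G g g' | Graph.adj-sym H h h' = refl

□adj-irrefl : ∀ {n m} (G : Graph n) (H : Graph m) x → □adj G H x x ≡ false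
□adj-irrefl G H (g , h)
  rewrite ⌊≟⌋-refl g | ⌊≟⌋-refl h | Graph.adj-irrefl G g | Graph.adj-irrefl H h = refl

-- Cartesian product G □ H on vertex set Fin (n * m); vertex (g , h) is
-- encoded as combine g h, decoded by remQuot (a bijection, Data.Fin.Properties).
_□_ : ∀ {n m} → Graph n → Graph m → Graph (n * m)
_□_ {n} {m} G H = record
  { adj        = λ x y → □adj G H (remQuot {n} m x) (remQuot {n} m y)
  ; adj-sym    = λ x y → □adj-sym G H (remQuot {n} m x) (remQuot {n} m y)
  ; adj-irrefl = λ x → □adj-irrefl G H (remQuot {n} m x)
  }

{-# OPTIONS --safe #-}

-- Project a 1/2-dominating set S of G □ H, where H has m ≥ 1 vertices, onto G.
-- The projection T is no larger than S, and N[S] lies inside the fibres over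
-- N[T], each of size m, so nm ≤ 2|N[S]| ≤ 2m|N[T]|: T is 1/2-dominating in G.

module Submission where

open import Defs
open import Data.Nat using (ℕ; _≤_; zero; suc; _+_; _*_; NonZero; z≤n; s≤s)
open import Data.Nat.Properties
  using (≤-refl; ≤-trans; ≤-reflexive; +-mono-≤; +-assoc; *-monoʳ-≤; *-cancelʳ-≤;
         *-comm; *-assoc; +-*-semiring; module ≤-Reasoning)
open import Data.Bool using (Bool; true; false; T; _∧_; if_then_else_)
open import Data.Bool.Properties using (T-∧; T-∨)
open import Data.Fin using (Fin; zero; suc; _≟_; combine; remQuot; quotient; _↑ˡ_; _↑ʳ_)
open import Data.Fin.Properties using (combine-remQuot; remQuot-combine)
open import Data.Fin.Subset using (Subset; ∣_∣)
open import Data.Vec using ([]; _∷_; tabulate; lookup)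
open import Data.Vec.Properties using (lookup∘tabulate)
open import Data.Product using (_×_; _,_; proj₁; proj₂; ∃)
open import Data.Sum using (inj₁; inj₂)
open import Data.Empty using (⊥-elim)
open import Function using (_∘_; Equivalence)
open import Relation.Nullary.Decidable using (⌊_⌋; toWitness; fromWitness)
open import Relation.Binary.PropositionalEquality
  using (_≡_; refl; sym; trans; cong; subst)
open import Algebra.Properties.Semiring.Sum +-*-semiring
  using (sum; sum-syntax; sum-cong-≗; *-distribˡ-sum)

open Equivalence using (to; from)

sum-mono-≤ : ∀ {k} {f g : Fin k → ℕ} → (∀ i → f i ≤ g i) → sum f ≤ sum g
sum-mono-≤ {zero}  f≤g = z≤n
sum-mono-≤ {suc k} f≤g = +-mono-≤ (f≤g zero) (sum-mono-≤ (f≤g ∘ suc))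

sum-↑ : ∀ m {k} (f : Fin (m + k) → ℕ) →
        sum f ≡ sum (f ∘ (_↑ˡ k)) + sum (f ∘ (m ↑ʳ_))
sum-↑ zero    f = refl
sum-↑ (suc m) {k} f = trans (cong (f zero +_) (sum-↑ m (f ∘ suc)))
  (sym (+-assoc (f zero) (sum (f ∘ suc ∘ (_↑ˡ k))) (sum (f ∘ suc ∘ (m ↑ʳ_)))))

sum-combine : ∀ n {m} (f : Fin (n * m) → ℕ) →
              sum f ≡ ∑[ g < n ] ∑[ h < m ] f (combine g h)
sum-combine zero        f = refl
sum-combine (suc n) {m} f =
  trans (sum-↑ m f) (cong (sum (f ∘ (_↑ˡ n * m)) +_) (sum-combine n (f ∘ (m ↑ʳ_))))

indicator : Bool → ℕ
indicator b = if b then 1 else 0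

count : ∀ {k} → (Fin k → Bool) → ℕ
count f = sum (indicator ∘ f)

∣p∣≡count-lookup : ∀ {k} (p : Subset k) → ∣ p ∣ ≡ count (lookup p)
∣p∣≡count-lookup []          = refl
∣p∣≡count-lookup (true ∷ p)  = cong suc (∣p∣≡count-lookup p)
∣p∣≡count-lookup (false ∷ p) = ∣p∣≡count-lookup p

∣tabulate∣≡count : ∀ {k} (f : Fin k → Bool) → ∣ tabulate f ∣ ≡ count f
∣tabulate∣≡count f =
  trans (∣p∣≡count-lookup (tabulate f)) (sum-cong-≗ (cong indicator ∘ lookup∘tabulate f))

indicator-mono : ∀ {a b} → (T a → T b) → indicator a ≤ indicator b
indicator-mono {false}         _   = z≤n
indicator-mono {true}  {true}  _   = ≤-refl
indicator-mono {true}  {false} a⇒b = ⊥-elim (a⇒b _)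

count-mono : ∀ {k} {f g : Fin k → Bool} → (∀ i → T (f i) → T (g i)) → count f ≤ count g
count-mono f⇒g = sum-mono-≤ (λ i → indicator-mono (f⇒g i))

count-const : ∀ k b → count {k} (λ _ → b) ≡ k * indicator b
count-const zero    b = refl
count-const (suc k) b = cong (indicator b +_) (count-const k b)

indicator-anyFin≤count : ∀ {k} (f : Fin k → Bool) → indicator (anyFin f) ≤ count f
indicator-anyFin≤count {zero}  f = z≤n
indicator-anyFin≤count {suc k} f with f zero
... | true  = s≤s z≤n
... | false = indicator-anyFin≤count (f ∘ suc)

anyFin⁺ : ∀ {k} (f : Fin k → Bool) i → T (f i) → T (anyFin f)
anyFin⁺ f zero    fi = from (T-∨ {f zero}) (inj₁ fi)
anyFin⁺ f (suc i) fi = from (T-∨ {f zero}) (inj₂ (anyFin⁺ (f ∘ suc) i fi))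

anyFin⁻ : ∀ {k} (f : Fin k → Bool) → T (anyFin f) → ∃ λ i → T (f i)
anyFin⁻ {suc k} f any with to (T-∨ {f zero}) any
... | inj₁ f0 = zero , f0
... | inj₂ any′ with i , fi ← anyFin⁻ (f ∘ suc) any′ = suc i , fi

lookup-tabulate⁺ : ∀ {k} (f : Fin k → Bool) i → T (f i) → T (lookup (tabulate f) i)
lookup-tabulate⁺ f i = subst T (sym (lookup∘tabulate f i))

lookup-tabulate⁻ : ∀ {k} (f : Fin k → Bool) i → T (lookup (tabulate f) i) → T (f i)
lookup-tabulate⁻ f i = subst T (lookup∘tabulate f i)

module _ {n} (G : Graph n) where

  inClosedNbhd-refl : ∀ v → T (inClosedNbhd G v v)
  inClosedNbhd-refl v = from (T-∨ {⌊ v ≟ v ⌋}) (inj₁ (fromWitness refl))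

  adj⇒inClosedNbhd : ∀ {v u} → T (adj G v u) → T (inClosedNbhd G v u)
  adj⇒inClosedNbhd {v} {u} vu = from (T-∨ {⌊ u ≟ v ⌋}) (inj₂ vu)

  N[]⁺ : ∀ S {v u} → T (lookup S v) → T (inClosedNbhd G v u) → T (lookup (N[ G ] S) u)
  N[]⁺ S {v} {u} v∈S vu =
    lookup-tabulate⁺ _ u (anyFin⁺ _ v (from (T-∧ {lookup S v}) (v∈S , vu)))

  N[]⁻ : ∀ S {u} → T (lookup (N[ G ] S) u) → ∃ λ v → T (lookup S v) × T (inClosedNbhd G v u)
  N[]⁻ S {u} u∈NS with v , p ← anyFin⁻ _ (lookup-tabulate⁻ _ u u∈NS) =
    v , to (T-∧ {lookup S v}) p

module _ {n m : ℕ} where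

  row : (Fin (n * m) → Bool) → Fin n → Fin m → Bool
  row f g h = f (combine g h)

  count≡∑count-row : ∀ f → count f ≡ ∑[ g < n ] count (row f g)
  count≡∑count-row f = sum-combine n (indicator ∘ f)

  count-occupiedRows≤count : ∀ f → count (λ g → anyFin (row f g)) ≤ count f
  count-occupiedRows≤count f = begin
    count (λ g → anyFin (row f g))  ≤⟨ sum-mono-≤ (λ g → indicator-anyFin≤count (row f g)) ⟩
    ∑[ g < n ] count (row f g)      ≡⟨ count≡∑count-row f ⟨
    count f                         ∎
    where open ≤-Reasoning

  count≤*count : ∀ f (t : Fin n → Bool) → (∀ g h → T (row f g h) → T (t g)) →
                 count f ≤ m * count t
  count≤*count f t f⇒t = begin
    count f                            ≡⟨ count≡∑count-row f ⟩
    ∑[ g < n ] count (row f g)         ≤⟨ sum-mono-≤ row≤ ⟩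
    ∑[ g < n ] (m * indicator (t g))   ≡⟨ *-distribˡ-sum m (indicator ∘ t) ⟨
    m * count t                        ∎
    where
    open ≤-Reasoning
    row≤ : ∀ g → count (row f g) ≤ m * indicator (t g)
    row≤ g = ≤-trans (count-mono (f⇒t g)) (≤-reflexive (count-const m (t g)))

  project : Subset (n * m) → Subset n
  project S = tabulate (λ g → anyFin (row (lookup S) g))

  project⁺ : ∀ S {v} → T (lookup S v) → T (lookup (project S) (quotient m v))
  project⁺ S {v} v∈S =
    lookup-tabulate⁺ (λ g → anyFin (row (lookup S) g)) g
      (anyFin⁺ (row (lookup S) g) h (subst (T ∘ lookup S) (sym (combine-remQuot {n} m v)) v∈S))
    where
    g = quotient m v
    h = proj₂ (remQuot {n} m v)

  ∣project[S]∣≤∣S∣ : ∀ S → ∣ project S ∣ ≤ ∣ S ∣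
  ∣project[S]∣≤∣S∣ S = begin
    ∣ project S ∣                            ≡⟨ ∣tabulate∣≡count (λ g → anyFin (row (lookup S) g)) ⟩
    count (λ g → anyFin (row (lookup S) g))  ≤⟨ count-occupiedRows≤count (lookup S) ⟩
    count (lookup S)                         ≡⟨ ∣p∣≡count-lookup S ⟨
    ∣ S ∣                                    ∎
    where open ≤-Reasoning

  module _ (G : Graph n) (H : Graph m) where

    □adj⇒inClosedNbhd : ∀ x y → T (□adj G H x y) → T (inClosedNbhd G (proj₁ x) (proj₁ y))
    □adj⇒inClosedNbhd (g , h) (g′ , h′) xy with to (T-∨ {⌊ g ≟ g′ ⌋ ∧ adj H h h′}) xy
    ... | inj₁ same-g = subst (T ∘ inClosedNbhd G g) g≡g′ (inClosedNbhd-refl G g)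
      where g≡g′ = toWitness (proj₁ (to (T-∧ {⌊ g ≟ g′ ⌋}) same-g))
    ... | inj₂ same-h = adj⇒inClosedNbhd G (proj₂ (to (T-∧ {⌊ h ≟ h′ ⌋}) same-h))

    quotient-inClosedNbhd : ∀ v x → T (inClosedNbhd (G □ H) v x) →
                            T (inClosedNbhd G (quotient m v) (quotient m x))
    quotient-inClosedNbhd v x vx with to (T-∨ {⌊ x ≟ v ⌋}) vx
    ... | inj₁ x≡v rewrite toWitness x≡v = inClosedNbhd-refl G (quotient m v)
    ... | inj₂ v~x = □adj⇒inClosedNbhd (remQuot m v) (remQuot m x) v~x

    N[]-project : ∀ S g h → T (lookup (N[ G □ H ] S) (combine g h)) →
                  T (lookup (N[ G ] (project S)) g)
    N[]-project S g h gh∈NS with v , v∈S , v~gh ← N[]⁻ (G □ H) S gh∈NS =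
      N[]⁺ G (project S) (project⁺ S v∈S)
        (subst (T ∘ inClosedNbhd G (quotient m v)) (cong proj₁ (remQuot-combine g h))
          (quotient-inClosedNbhd v (combine g h) v~gh))

    ∣N[S]∣≤m*∣N[project[S]]∣ : ∀ S → ∣ N[ G □ H ] S ∣ ≤ m * ∣ N[ G ] (project S) ∣
    ∣N[S]∣≤m*∣N[project[S]]∣ S = begin
      ∣ NS ∣                ≡⟨ ∣p∣≡count-lookup NS ⟩
      count (lookup NS)     ≤⟨ count≤*count (lookup NS) (lookup NT) (N[]-project S) ⟩
      m * count (lookup NT) ≡⟨ cong (m *_) (∣p∣≡count-lookup NT) ⟨
      m * ∣ NT ∣            ∎
      where
      open ≤-Reasoning
      NS = N[ G □ H ] S
      NT = N[ G ] (project S)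

    project-isHalfDominating : .{{_ : NonZero m}} → ∀ S →
      IsHalfDominating (G □ H) S → IsHalfDominating G (project S)
    project-isHalfDominating S S-dom = *-cancelʳ-≤ n (2 * ∣NT∣) m (begin
      n * m                 ≤⟨ S-dom ⟩
      2 * ∣ N[ G □ H ] S ∣  ≤⟨ *-monoʳ-≤ 2 (∣N[S]∣≤m*∣N[project[S]]∣ S) ⟩
      2 * (m * ∣NT∣)        ≡⟨ cong (2 *_) (*-comm m ∣NT∣) ⟩
      2 * (∣NT∣ * m)        ≡⟨ *-assoc 2 ∣NT∣ m ⟨
      2 * ∣NT∣ * m          ∎)
      where
      open ≤-Reasoning
      ∣NT∣ = ∣ N[ G ] (project S) ∣

mainTheorem4 : (n : ℕ) (G : Graph n) (a b : ℕ) →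
    IsGammaHalf (G □ P₂) a → IsGammaHalf G b → b ≤ a
mainTheorem4 n G a b ((S , S-dom , refl) , _) (_ , b-minimal) = begin
  b                        ≤⟨ b-minimal (project S) (project-isHalfDominating G P₂ S S-dom) ⟩
  ∣ project {n} {2} S ∣    ≤⟨ ∣project[S]∣≤∣S∣ {n} {2} S ⟩
  ∣ S ∣                    ∎
  where open ≤-Reasoning
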